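{- Let $1\leq l\leq k$ and let $\mathcal{F}=(V,\mathcal{E})$ be a $k$-uniform $l$-hypertree with $n$ vertices and $m$ edges. Then $m\leq \frac{1}{k-l+1}\binom{n}{k-1}$.
   Context: Hypergraphs are finite, $k$-uniform and have no multiple edges. A chain is a nonempty $k$-uniform hypergraph admitting a sequence $v_1,\dots,v_s$ of its vertices, in which every vertex appears at least once, with $v_1\ne v_s$, such that the sets $\{v_i,\dots,v_{i+k-1}\}$ ($1\le i\le s-k+1$) are pairwise distinct and are exactly its edges; its length is its number of edges $s-k+1$. A semicycle is defined the same way but with $v_1=v_s$. A hypergraph is chain-connected if every pair of its vertices lies in some subhypergraph that is a chain, and semicycle-free if it has no subhypergraph that is a semicycle. A hypertree is a chain-connected semicycle-free $k$-uniform hypergraph. An $l$-hypertree is a hypertree in which every chain (subhypergraph that is a chain) has length at most $l$. -}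

module Defs where

open import Data.Nat using (ℕ; zero; suc; _≤_; _≤?_)
open import Data.Fin using (Fin)
open import Data.Fin.Subset using (Subset; ⊥; ⁅_⁆; _∪_; ∣_∣)
open import Data.List using (List; []; _∷_; length; take; map; foldr)
open import Data.List.NonEmpty using (List⁺; toList; head; last)
open import Data.List.Relation.Unary.All using (All)
open import Data.List.Relation.Unary.Unique.Propositional using (Unique)
open import Data.List.Membership.Propositional using (_∈_)
open import Data.Product using (_×_; Σ)
open import Relation.Binary.PropositionalEquality using (_≡_; _≢_)
open import Relation.Nullary using (¬_; yes; no)

record UniformHypergraph (k : ℕ) : Set where
  field
    n        : ℕ
    edges    : List (Subset n)
    distinct : Unique edges
    uniform  : All (λ e → ∣ e ∣ ≡ k) edges
open UniformHypergraph public

numEdges : ∀ {k} → UniformHypergraph k → ℕ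
numEdges H = length (edges H)

windows : {A : Set} → ℕ → List A → List (List A)
windows k [] = []
windows k (x ∷ xs) with k ≤? suc (length xs)
... | yes _ = take k (x ∷ xs) ∷ windows k xs
... | no  _ = []

toSet : ∀ {n} → List (Fin n) → Subset n
toSet = foldr (λ v s → ⁅ v ⁆ ∪ s) ⊥

windowSets : ∀ {n} → ℕ → List⁺ (Fin n) → List (Subset n)
windowSets k vs = map toSet (windows k (toList vs))

-- A vertex sequence v_1..v_s whose windows are pairwise distinct, at least one
-- window exists (nonempty), and all windows are edges of H: the hypergraph it
-- determines is then a subhypergraph of H.
SubSeq : ∀ {k} (H : UniformHypergraph k) → List⁺ (Fin (n H)) → Set
SubSeq {k} H vs =
  (k ≤ length (toList vs)) ×
  Unique (windowSets k vs) ×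
  All (_∈ edges H) (windowSets k vs)

IsSubChain : ∀ {k} (H : UniformHypergraph k) → List⁺ (Fin (n H)) → Set
IsSubChain H vs = SubSeq H vs × (head vs ≢ last vs)

IsSubSemicycle : ∀ {k} (H : UniformHypergraph k) → List⁺ (Fin (n H)) → Set
IsSubSemicycle H vs = SubSeq H vs × (head vs ≡ last vs)

chainLength : ℕ → ∀ {n} → List⁺ (Fin n) → ℕ
chainLength k vs = length (windows k (toList vs))

ChainConnected : ∀ {k} → UniformHypergraph k → Set
ChainConnected H = ∀ (u v : Fin (n H)) → u ≢ v →
  Σ (List⁺ (Fin (n H))) λ vs → IsSubChain H vs × (u ∈ toList vs) × (v ∈ toList vs)

SemicycleFree : ∀ {k} → UniformHypergraph k → Set
SemicycleFree H = ∀ (vs : List⁺ (Fin (n H))) → ¬ IsSubSemicycle H vs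

IsHypertree : ∀ {k} → UniformHypergraph k → Set
IsHypertree H = ChainConnected H × SemicycleFree H

IsLHypertree : ℕ → ∀ {k} → UniformHypergraph k → Set
IsLHypertree l {k} H = IsHypertree H ×
  (∀ (vs : List⁺ (Fin (n H))) → IsSubChain H vs → chainLength k vs ≤ l)

-- Call a (k-1)-subset f of an edge W private to W within a set E of edges if W is the only
-- edge of E containing f. Every nonempty E has an edge with at least k - l + 1 private faces:
-- view an edge of E as a chain of one edge, with core M its whole vertex set. While some face
-- W - x of the last edge W, with x in the core, lies in another edge e of E, append e: move x
-- to the front, drop it from the core and put the vertex of e outside W at the back. The new
-- edge misses x, which lies in all earlier edges, so the edges stay distinct; semicycle-freeness
-- makes the sequence a chain, so it has at most l edges, and the growth stops while the core
-- still has at least k - l + 1 vertices, each giving a private face. Removing that edge from E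
-- and repeating produces (k - l + 1) m distinct (k-1)-sets, whence the binomial bound.

module Submission where

open import Defs
open import Data.Bool.Properties using () renaming (_≟_ to _≟ᵇ_)
open import Data.Empty using (⊥-elim)
open import Data.Fin using (Fin; zero; suc)
open import Data.Fin.Properties using () renaming (any? to anyᶠ?; _≟_ to _≟ᶠ_)
open import Data.Fin.Subset
  using (Subset; inside; outside; ⁅_⁆; _∪_; _-_; ∣_∣; _⊆_)
  renaming (_∈_ to _∈ₛ_; _∉_ to _∉ₛ_; ⊥ to ∅)
open import Data.Fin.Subset.Properties
  using ( x∈p∪q⁺; x∈p∪q⁻; x∈⁅x⁆; x∈⁅y⁆⇒x≡y; ∉⊥; ∪-identityˡ; ∣⊥∣≡0; _∈?_; _⊆?_
        ; ⊆-antisym; p⊂q⇒∣p∣<∣q∣; p─⊥≡p; p─q⊆p; x∈p∧x≢y⇒x∈p-y)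
open import Data.List using (List; []; _∷_; _++_; [_]; _∷ʳ_; length; take; drop; map; applyUpTo)
open import Data.List.Membership.Propositional using (_∈_; _∉_; find; lose)
open import Data.List.Membership.Propositional.Properties
  using (∈-∃++; ∈-++⁺ˡ; ∈-++⁺ʳ; ∈-applyUpTo⁺; ∈-applyUpTo⁻)
open import Data.List.NonEmpty using (List⁺; _∷_; toList; head; last)
open import Data.List.Properties
  using ( length-map; length-drop; length-++; length-applyUpTo; map-applyUpTo; applyUpTo-∷ʳ
        ; drop-all; take-all; ++-assoc; ++-identityʳ)
open import Data.List.Relation.Binary.Permutation.Propositional using (_↭_; ↭-sym; ↭⇒↭ₛ)
open import Data.List.Relation.Binary.Permutation.Propositional.Properties
  using (∈-resp-↭; All-resp-↭; shift; ↭-length; ++⁺ˡ; ++⁺ʳ)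
import Data.List.Relation.Binary.Permutation.Setoid.Properties as Permutationₛ
open import Data.List.Relation.Unary.All as All using (All; []; _∷_)
import Data.List.Relation.Unary.All.Properties as All
open import Data.List.Relation.Unary.Any using (here; there; any?)
open import Data.List.Relation.Unary.Unique.Propositional using (Unique; []; _∷_)
import Data.List.Relation.Unary.Unique.Propositional.Properties as Unique
open import Data.Nat using (ℕ; zero; suc; _≤_; _<_; _≤?_; z≤n; s≤s; s≤s⁻¹; _+_; _*_; _∸_)
open import Data.Nat.Combinatorics using (_C_; nCk+nC[k+1]≡[n+1]C[k+1])
open import Data.Nat.Properties
  using ( ≤-refl; ≤-trans; ≤-reflexive; <-irrefl; ≰⇒>; m≤n⇒m≤1+n; m≤m+n; suc-injective
        ; +-assoc; +-comm; +-suc; +-identityʳ; *-suc; *-zeroʳ; +-mono-≤; ∸-monoʳ-≤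
        ; +-∸-assoc; m∸n+n≡m; m+n∸m≡n; m≤n⇒m∸n≡0; module ≤-Reasoning)
open import Data.Product using (_×_; _,_; ∃; proj₁; proj₂)
open import Data.Sum using (_⊎_; inj₁; inj₂)
open import Data.Vec using ([]; _∷_; here; there)
open import Data.Vec.Properties using (≡-dec)
open import Function using (_∘_; id)
open import Relation.Binary.PropositionalEquality hiding ([_])
open import Relation.Nullary using (¬_; yes; no; ¬?; _×-dec_)

private variable
  A : Set
  m : ℕ

∈-toSet⁺ : ∀ {x : Fin m} {xs} → x ∈ xs → x ∈ₛ toSet xs
∈-toSet⁺ {xs = y ∷ _} (here refl) = x∈p∪q⁺ (inj₁ (x∈⁅x⁆ y))
∈-toSet⁺ {xs = _ ∷ _} (there x∈xs) = x∈p∪q⁺ (inj₂ (∈-toSet⁺ x∈xs))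

∈-toSet⁻ : ∀ {x : Fin m} xs → x ∈ₛ toSet xs → x ∈ xs
∈-toSet⁻ [] x∈∅ = ⊥-elim (∉⊥ x∈∅)
∈-toSet⁻ (y ∷ xs) x∈ with x∈p∪q⁻ ⁅ y ⁆ (toSet xs) x∈
... | inj₁ x∈⁅y⁆ = here (x∈⁅y⁆⇒x≡y y x∈⁅y⁆)
... | inj₂ x∈xs = there (∈-toSet⁻ xs x∈xs)

toSet-resp-↭ : {xs ys : List (Fin m)} → xs ↭ ys → toSet xs ≡ toSet ys
toSet-resp-↭ {xs = xs} {ys} xs↭ys = ⊆-antisym
  (λ x∈ → ∈-toSet⁺ (∈-resp-↭ xs↭ys (∈-toSet⁻ xs x∈)))
  (λ x∈ → ∈-toSet⁺ (∈-resp-↭ (↭-sym xs↭ys) (∈-toSet⁻ ys x∈)))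

x∈p⇒⁅x⁆∪p≡p : ∀ {x : Fin m} {p} → x ∈ₛ p → ⁅ x ⁆ ∪ p ≡ p
x∈p⇒⁅x⁆∪p≡p {x = zero}  {inside ∷ p} here = cong (inside ∷_) (∪-identityˡ p)
x∈p⇒⁅x⁆∪p≡p {x = suc _} {s ∷ _} (there x∈p) = cong (s ∷_) (x∈p⇒⁅x⁆∪p≡p x∈p)

x∉p⇒∣⁅x⁆∪p∣≡1+∣p∣ : ∀ {x : Fin m} {p} → x ∉ₛ p → ∣ ⁅ x ⁆ ∪ p ∣ ≡ suc ∣ p ∣
x∉p⇒∣⁅x⁆∪p∣≡1+∣p∣ {x = zero}  {inside ∷ _} x∉p = ⊥-elim (x∉p here)
x∉p⇒∣⁅x⁆∪p∣≡1+∣p∣ {x = zero}  {outside ∷ p} _ = cong (suc ∘ ∣_∣) (∪-identityˡ p)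
x∉p⇒∣⁅x⁆∪p∣≡1+∣p∣ {x = suc _} {inside ∷ _} x∉p = cong suc (x∉p⇒∣⁅x⁆∪p∣≡1+∣p∣ (x∉p ∘ there))
x∉p⇒∣⁅x⁆∪p∣≡1+∣p∣ {x = suc _} {outside ∷ _} x∉p = x∉p⇒∣⁅x⁆∪p∣≡1+∣p∣ (x∉p ∘ there)

x∈p⇒1+∣p-x∣≡∣p∣ : ∀ {x : Fin m} {p} → x ∈ₛ p → suc ∣ p - x ∣ ≡ ∣ p ∣
x∈p⇒1+∣p-x∣≡∣p∣ {x = zero}  {inside ∷ p} here = cong (suc ∘ ∣_∣) (p─⊥≡p p)
x∈p⇒1+∣p-x∣≡∣p∣ {x = suc _} {inside ∷ _} (there x∈p) = cong suc (x∈p⇒1+∣p-x∣≡∣p∣ x∈p)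
x∈p⇒1+∣p-x∣≡∣p∣ {x = suc _} {outside ∷ _} (there x∈p) = x∈p⇒1+∣p-x∣≡∣p∣ x∈p

x∉p-x : ∀ {x : Fin m} p → x ∉ₛ p - x
x∉p-x {x = zero}  (inside ∷ _) ()
x∉p-x {x = zero}  (outside ∷ _) ()
x∉p-x {x = suc _} (_ ∷ p) (there x∈) = x∉p-x p x∈

∣toSet∣≤length : (xs : List (Fin m)) → ∣ toSet xs ∣ ≤ length xs
∣toSet∣≤length {m} [] = ≤-reflexive (∣⊥∣≡0 m)
∣toSet∣≤length (x ∷ xs) with x ∈? toSet xs
... | yes x∈ rewrite x∈p⇒⁅x⁆∪p≡p x∈ = m≤n⇒m≤1+n (∣toSet∣≤length xs)
... | no x∉ rewrite x∉p⇒∣⁅x⁆∪p∣≡1+∣p∣ x∉ = s≤s (∣toSet∣≤length xs)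

length≤∣toSet∣⇒Unique : (xs : List (Fin m)) → length xs ≤ ∣ toSet xs ∣ → Unique xs
length≤∣toSet∣⇒Unique [] _ = []
length≤∣toSet∣⇒Unique (x ∷ xs) ≤∣toSet∣ with x ∈? toSet xs
... | yes x∈ rewrite x∈p⇒⁅x⁆∪p≡p x∈ =
  ⊥-elim (<-irrefl refl (≤-trans ≤∣toSet∣ (∣toSet∣≤length xs)))
... | no x∉ rewrite x∉p⇒∣⁅x⁆∪p∣≡1+∣p∣ x∉ =
  All.tabulate (λ x∈xs x≡ → x∉ (∈-toSet⁺ (subst (_∈ xs) (sym x≡) x∈xs)))
  ∷ length≤∣toSet∣⇒Unique xs (s≤s⁻¹ ≤∣toSet∣)

p⊈q⇒∃∈∉ : {p q : Subset m} → ¬ p ⊆ q → ∃ λ x → x ∈ₛ p × x ∉ₛ q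
p⊈q⇒∃∈∉ {p = p} {q} p⊈q with anyᶠ? (λ x → x ∈? p ×-dec ¬? (x ∈? q))
... | yes witness = witness
... | no none = ⊥-elim (p⊈q p⊆q)
  where
  p⊆q : p ⊆ q
  p⊆q {x} x∈p with x ∈? q
  ... | yes x∈q = x∈q
  ... | no x∉q = ⊥-elim (none (x , x∈p , x∉q))

p⊆q∧∣q∣≤∣p∣⇒p≡q : {p q : Subset m} → p ⊆ q → ∣ q ∣ ≤ ∣ p ∣ → p ≡ q
p⊆q∧∣q∣≤∣p∣⇒p≡q {p = p} {q} p⊆q ∣q∣≤∣p∣ with q ⊆? p
... | yes q⊆p = ⊆-antisym p⊆q q⊆p
... | no q⊈p = ⊥-elim (<-irrefl refl (≤-trans (p⊂q⇒∣p∣<∣q∣ (p⊆q , p⊈q⇒∃∈∉ q⊈p)) ∣q∣≤∣p∣))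

elements : Subset m → List (Fin m)
elements [] = []
elements (inside ∷ p) = zero ∷ map suc (elements p)
elements (outside ∷ p) = map suc (elements p)

length-elements : (p : Subset m) → length (elements p) ≡ ∣ p ∣
length-elements [] = refl
length-elements (inside ∷ p) = cong suc (trans (length-map suc (elements p)) (length-elements p))
length-elements (outside ∷ p) = trans (length-map suc (elements p)) (length-elements p)

toSet-map-suc : (xs : List (Fin m)) → toSet (map suc xs) ≡ outside ∷ toSet xs
toSet-map-suc [] = refl
toSet-map-suc (x ∷ xs) = cong (⁅ suc x ⁆ ∪_) (toSet-map-suc xs)

toSet-elements : (p : Subset m) → toSet (elements p) ≡ p
toSet-elements [] = refl
toSet-elements (inside ∷ p) = begin
  ⁅ zero ⁆ ∪ toSet (map suc (elements p)) ≡⟨ cong (⁅ zero ⁆ ∪_) (toSet-map-suc (elements p)) ⟩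
  inside ∷ (∅ ∪ toSet (elements p))      ≡⟨ cong (inside ∷_) (∪-identityˡ _) ⟩
  inside ∷ toSet (elements p)            ≡⟨ cong (inside ∷_) (toSet-elements p) ⟩
  inside ∷ p                             ∎
  where open ≡-Reasoning
toSet-elements (outside ∷ p) =
  trans (toSet-map-suc (elements p)) (cong (outside ∷_) (toSet-elements p))

inTails : List (Subset (suc m)) → List (Subset m)
inTails [] = []
inTails ((inside ∷ p) ∷ L) = p ∷ inTails L
inTails ((outside ∷ _) ∷ L) = inTails L

outTails : List (Subset (suc m)) → List (Subset m)
outTails [] = []
outTails ((inside ∷ _) ∷ L) = outTails L
outTails ((outside ∷ p) ∷ L) = p ∷ outTails L

length-in+outTails : (L : List (Subset (suc m))) → length L ≡ length (inTails L) + length (outTails L)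
length-in+outTails [] = refl
length-in+outTails ((inside ∷ _) ∷ L) = cong suc (length-in+outTails L)
length-in+outTails ((outside ∷ _) ∷ L) = trans (cong suc (length-in+outTails L)) (sym (+-suc _ _))

∈-inTails : ∀ {p} (L : List (Subset (suc m))) → p ∈ inTails L → inside ∷ p ∈ L
∈-inTails ((inside ∷ _) ∷ _) (here refl) = here refl
∈-inTails ((inside ∷ _) ∷ L) (there p∈) = there (∈-inTails L p∈)
∈-inTails ((outside ∷ _) ∷ L) p∈ = there (∈-inTails L p∈)

∈-outTails : ∀ {p} (L : List (Subset (suc m))) → p ∈ outTails L → outside ∷ p ∈ L
∈-outTails ((outside ∷ _) ∷ _) (here refl) = here refl
∈-outTails ((outside ∷ _) ∷ L) (there p∈) = there (∈-outTails L p∈)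
∈-outTails ((inside ∷ _) ∷ L) p∈ = there (∈-outTails L p∈)

inTails-unique : (L : List (Subset (suc m))) → Unique L → Unique (inTails L)
inTails-unique [] [] = []
inTails-unique ((inside ∷ _) ∷ L) (p∉L ∷ u) =
  All.tabulate (λ q∈ p≡q → All.lookup p∉L (∈-inTails L q∈) (cong (inside ∷_) p≡q))
  ∷ inTails-unique L u
inTails-unique ((outside ∷ _) ∷ L) (_ ∷ u) = inTails-unique L u

outTails-unique : (L : List (Subset (suc m))) → Unique L → Unique (outTails L)
outTails-unique [] [] = []
outTails-unique ((outside ∷ _) ∷ L) (p∉L ∷ u) =
  All.tabulate (λ q∈ p≡q → All.lookup p∉L (∈-outTails L q∈) (cong (outside ∷_) p≡q))
  ∷ outTails-unique L u
outTails-unique ((inside ∷ _) ∷ L) (_ ∷ u) = outTails-unique L u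

inTails-size : ∀ {j} (L : List (Subset (suc m))) →
  All (λ p → ∣ p ∣ ≡ suc j) L → All (λ p → ∣ p ∣ ≡ j) (inTails L)
inTails-size [] [] = []
inTails-size ((inside ∷ _) ∷ L) (∣p∣≡ ∷ sizes) = suc-injective ∣p∣≡ ∷ inTails-size L sizes
inTails-size ((outside ∷ _) ∷ L) (_ ∷ sizes) = inTails-size L sizes

inTails-empty : (L : List (Subset (suc m))) → All (λ p → ∣ p ∣ ≡ 0) L → inTails L ≡ []
inTails-empty [] [] = refl
inTails-empty ((outside ∷ _) ∷ L) (_ ∷ sizes) = inTails-empty L sizes

outTails-size : ∀ {j} (L : List (Subset (suc m))) →
  All (λ p → ∣ p ∣ ≡ j) L → All (λ p → ∣ p ∣ ≡ j) (outTails L)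
outTails-size [] [] = []
outTails-size ((inside ∷ _) ∷ L) (_ ∷ sizes) = outTails-size L sizes
outTails-size ((outside ∷ _) ∷ L) (∣p∣≡ ∷ sizes) = ∣p∣≡ ∷ outTails-size L sizes

length≤C : ∀ m j (L : List (Subset m)) → Unique L → All (λ p → ∣ p ∣ ≡ j) L → length L ≤ m C j
length≤C zero zero [] _ _ = z≤n
length≤C zero zero ([] ∷ []) _ _ = ≤-refl
length≤C zero zero ([] ∷ [] ∷ _) ((≢[] ∷ _) ∷ _) _ = ⊥-elim (≢[] refl)
length≤C zero (suc j) [] _ _ = z≤n
length≤C zero (suc j) ([] ∷ _) _ (() ∷ _)
length≤C (suc m) zero L u sizes = begin
  length L                                ≡⟨ length-in+outTails L ⟩
  length (inTails L) + length (outTails L) ≡⟨ cong (λ I → length I + length (outTails L)) (inTails-empty L sizes) ⟩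
  length (outTails L)                     ≤⟨ length≤C m zero (outTails L) (outTails-unique L u) (outTails-size L sizes) ⟩
  1                                       ∎
  where open ≤-Reasoning
length≤C (suc m) (suc j) L u sizes = begin
  length L                                 ≡⟨ length-in+outTails L ⟩
  length (inTails L) + length (outTails L) ≤⟨ +-mono-≤ (length≤C m j (inTails L) (inTails-unique L u) (inTails-size L sizes))
                                                       (length≤C m (suc j) (outTails L) (outTails-unique L u) (outTails-size L sizes)) ⟩
  m C j + m C suc j                        ≡⟨ nCk+nC[k+1]≡[n+1]C[k+1] m j ⟩
  suc m C suc j                            ∎
  where open ≤-Reasoning

applyUpTo-cong : ∀ (f g : ℕ → A) n → (∀ {j} → j < n → f j ≡ g j) → applyUpTo f n ≡ applyUpTo g n
applyUpTo-cong f g zero _ = refl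
applyUpTo-cong f g (suc n) f≗g = cong₂ _∷_ (f≗g (s≤s z≤n)) (applyUpTo-cong (f ∘ suc) (g ∘ suc) n (f≗g ∘ s≤s))

windows-short : ∀ k (xs : List A) → length xs < k → windows k xs ≡ []
windows-short k [] _ = refl
windows-short k (x ∷ xs) |xs|<k with k ≤? suc (length xs)
... | yes k≤ = ⊥-elim (<-irrefl refl (≤-trans |xs|<k k≤))
... | no _ = refl

windows≡applyUpTo : ∀ k (xs : List A) → 1 ≤ k → k ≤ length xs →
  windows k xs ≡ applyUpTo (λ j → take k (drop j xs)) (suc (length xs ∸ k))
windows≡applyUpTo k [] 1≤k k≤0 = ⊥-elim (<-irrefl refl (≤-trans 1≤k k≤0))
windows≡applyUpTo k (x ∷ xs) 1≤k k≤ with k ≤? suc (length xs)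
... | no k≰ = ⊥-elim (k≰ k≤)
... | yes _ with k ≤? length xs
...   | yes k≤|xs| = cong (take k (x ∷ xs) ∷_) (trans (windows≡applyUpTo k xs 1≤k k≤|xs|)
          (cong (applyUpTo (λ j → take k (drop j xs))) (sym (+-∸-assoc 1 k≤|xs|))))
...   | no k≰|xs| = cong (take k (x ∷ xs) ∷_) (trans (windows-short k xs (≰⇒> k≰|xs|))
          (cong (applyUpTo (λ j → take k (drop j xs))) (sym (m≤n⇒m∸n≡0 (≰⇒> k≰|xs|)))))

drop-++ˡ : ∀ j (xs ys : List A) → j ≤ length xs → drop j (xs ++ ys) ≡ drop j xs ++ ys
drop-++ˡ zero _ _ _ = refl
drop-++ˡ (suc j) (_ ∷ xs) ys (s≤s j≤) = drop-++ˡ j xs ys j≤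

take-++ˡ : ∀ j (xs ys : List A) → j ≤ length xs → take j (xs ++ ys) ≡ take j xs
take-++ˡ zero _ _ _ = refl
take-++ˡ (suc j) (x ∷ xs) ys (s≤s j≤) = cong (x ∷_) (take-++ˡ j xs ys j≤)

take-length-++ : ∀ (xs ys : List A) j → take (length xs + j) (xs ++ ys) ≡ xs ++ take j ys
take-length-++ [] _ _ = refl
take-length-++ (x ∷ xs) ys j = cong (x ∷_) (take-length-++ xs ys j)

take-drop-middle : ∀ (P M Q : List A) j → j ≤ length P →
  take (length P + length M) (drop j (P ++ M ++ Q)) ≡ drop j P ++ M ++ take j Q
take-drop-middle P M Q j j≤ = begin
  take (length P + length M) (drop j (P ++ M ++ Q))
    ≡⟨ cong₂ take |P|+|M|≡ (drop-++ˡ j P (M ++ Q) j≤) ⟩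
  take (length (drop j P) + (length M + j)) (drop j P ++ M ++ Q)
    ≡⟨ take-length-++ (drop j P) (M ++ Q) (length M + j) ⟩
  drop j P ++ take (length M + j) (M ++ Q)
    ≡⟨ cong (drop j P ++_) (take-length-++ M Q j) ⟩
  drop j P ++ M ++ take j Q ∎
  where
  open ≡-Reasoning
  |P|+|M|≡ : length P + length M ≡ length (drop j P) + (length M + j)
  |P|+|M|≡ = begin
    length P + length M             ≡⟨ cong (_+ length M) (sym (m∸n+n≡m j≤)) ⟩
    (length P ∸ j + j) + length M   ≡⟨ +-assoc (length P ∸ j) j (length M) ⟩
    length P ∸ j + (j + length M)   ≡⟨ cong₂ _+_ (sym (length-drop j P)) (+-comm j (length M)) ⟩
    length (drop j P) + (length M + j) ∎

∈⇒↭∷ : ∀ {x : A} {xs} → x ∈ xs → ∃ λ ys → xs ↭ x ∷ ys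
∈⇒↭∷ x∈xs with ys , zs , refl ← ∈-∃++ x∈xs = ys ++ zs , shift _ ys zs

Unique-resp-↭ : {xs ys : List A} → xs ↭ ys → Unique xs → Unique ys
Unique-resp-↭ {A = A} xs↭ys = Permutationₛ.Unique-resp-↭ (setoid A) (↭⇒↭ₛ xs↭ys)

Unique-++⁻ˡ : ∀ (xs : List A) {ys} → Unique (xs ++ ys) → Unique xs
Unique-++⁻ˡ [] _ = []
Unique-++⁻ˡ (x ∷ xs) (x∉ ∷ u) = All.tabulate (All.lookup x∉ ∘ ∈-++⁺ˡ) ∷ Unique-++⁻ˡ xs u

removals-unique : ∀ {p : Subset m} {xs} → All (_∈ₛ p) xs → Unique xs → Unique (map (p -_) xs)
removals-unique [] [] = []
removals-unique {p = p} (_ ∷ xs⊆p) (x∉xs ∷ u) =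
  All.map⁺ (All.zipWith p-x≢p-y (x∉xs , xs⊆p)) ∷ removals-unique xs⊆p u
  where
  p-x≢p-y : ∀ {x y} → x ≢ y × y ∈ₛ p → p - x ≢ p - y
  p-x≢p-y (x≢y , y∈p) p-x≡p-y = x∉p-x p (subst (_ ∈ₛ_) p-x≡p-y (x∈p∧x≢y⇒x∈p-y y∈p (x≢y ∘ sym)))

length-∷ʳ : ∀ (xs : List A) {x} → length (xs ++ [ x ]) ≡ suc (length xs)
length-∷ʳ xs = trans (length-++ xs) (+-comm (length xs) 1)

-- Both sides contain ⁅ y ⁆ ∪ (T - x), which already has ∣ e ∣ elements.
exchange : ∀ {x y : Fin m} R {T e} → toSet (x ∷ R) ≡ T → ∣ T ∣ ≡ ∣ e ∣ → length R < ∣ e ∣ →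
  T - x ⊆ e → y ∈ₛ e → y ∉ₛ T → toSet (R ++ [ y ]) ≡ e
exchange {x = x} {y} R {T} {e} refl ∣T∣≡∣e∣ |R|<∣e∣ T-x⊆e y∈e y∉T = trans (sym e₀≡S) e₀≡e
  where
  e₀ S : Subset _
  e₀ = ⁅ y ⁆ ∪ (T - x)
  S = toSet (R ++ [ y ])

  ∣e₀∣≡∣e∣ : ∣ e₀ ∣ ≡ ∣ e ∣
  ∣e₀∣≡∣e∣ = begin
    ∣ ⁅ y ⁆ ∪ (T - x) ∣ ≡⟨ x∉p⇒∣⁅x⁆∪p∣≡1+∣p∣ (y∉T ∘ p─q⊆p T ⁅ x ⁆) ⟩
    suc ∣ T - x ∣       ≡⟨ x∈p⇒1+∣p-x∣≡∣p∣ (x∈p∪q⁺ (inj₁ (x∈⁅x⁆ x))) ⟩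
    ∣ T ∣               ≡⟨ ∣T∣≡∣e∣ ⟩
    ∣ e ∣               ∎
    where open ≡-Reasoning

  e₀⊆e : e₀ ⊆ e
  e₀⊆e z∈e₀ with x∈p∪q⁻ ⁅ y ⁆ (T - x) z∈e₀
  ... | inj₁ z∈⁅y⁆ = subst (_∈ₛ e) (sym (x∈⁅y⁆⇒x≡y y z∈⁅y⁆)) y∈e
  ... | inj₂ z∈T-x = T-x⊆e z∈T-x

  e₀⊆S : e₀ ⊆ S
  e₀⊆S z∈e₀ with x∈p∪q⁻ ⁅ y ⁆ (T - x) z∈e₀
  ... | inj₁ z∈⁅y⁆ = ∈-toSet⁺ (∈-++⁺ʳ R (here (x∈⁅y⁆⇒x≡y y z∈⁅y⁆)))
  ... | inj₂ z∈T-x with x∈p∪q⁻ ⁅ x ⁆ (toSet R) (p─q⊆p T ⁅ x ⁆ z∈T-x)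
  ...   | inj₁ z∈⁅x⁆ = ⊥-elim (x∉p-x T (subst (_∈ₛ T - x) (x∈⁅y⁆⇒x≡y x z∈⁅x⁆) z∈T-x))
  ...   | inj₂ z∈R = ∈-toSet⁺ (∈-++⁺ˡ (∈-toSet⁻ R z∈R))

  ∣S∣≤∣e₀∣ : ∣ S ∣ ≤ ∣ e₀ ∣
  ∣S∣≤∣e₀∣ = begin
    ∣ S ∣                ≤⟨ ∣toSet∣≤length (R ++ [ y ]) ⟩
    length (R ++ [ y ])  ≡⟨ length-∷ʳ R ⟩
    suc (length R)       ≤⟨ |R|<∣e∣ ⟩
    ∣ e ∣                ≡⟨ ∣e₀∣≡∣e∣ ⟨
    ∣ e₀ ∣               ∎
    where open ≤-Reasoning

  e₀≡e : e₀ ≡ e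
  e₀≡e = p⊆q∧∣q∣≤∣p∣⇒p≡q e₀⊆e (≤-reflexive (sym ∣e₀∣≡∣e∣))

  e₀≡S : e₀ ≡ S
  e₀≡S = p⊆q∧∣q∣≤∣p∣⇒p≡q e₀⊆S ∣S∣≤∣e₀∣

-- P ++ M ++ Q has a + 1 windows of length k, the j-th being drop j P ++ M ++ take j Q,
-- so every window contains the core M.
record Split (k a : ℕ) (A : Set) : Set where
  field
    P M Q : List A
    |P|≡a : length P ≡ a
    |Q|≡a : length Q ≡ a
    |P|+|M|≡k : length P + length M ≡ k

module _ {k a : ℕ} (s : Split k a A) where
  open Split s

  sequence : List A
  sequence = P ++ M ++ Q

  length-sequence : length sequence ≡ k + a
  length-sequence = begin
    length (P ++ M ++ Q)                ≡⟨ length-++ P ⟩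
    length P + length (M ++ Q)          ≡⟨ cong (length P +_) (length-++ M) ⟩
    length P + (length M + length Q)    ≡⟨ sym (+-assoc (length P) _ _) ⟩
    (length P + length M) + length Q    ≡⟨ cong₂ _+_ |P|+|M|≡k |Q|≡a ⟩
    k + a                               ∎
    where open ≡-Reasoning

  k≤length-sequence : k ≤ length sequence
  k≤length-sequence = subst (k ≤_) (sym length-sequence) (m≤m+n k a)

  windows-sequence : 1 ≤ k →
    windows k sequence ≡ applyUpTo (λ j → drop j P ++ M ++ take j Q) (suc a)
  windows-sequence 1≤k = begin
    windows k sequence
      ≡⟨ windows≡applyUpTo k sequence 1≤k k≤length-sequence ⟩
    applyUpTo (λ j → take k (drop j sequence)) (suc (length sequence ∸ k))
      ≡⟨ cong (λ n → applyUpTo (λ j → take k (drop j sequence)) (suc n))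
              (trans (cong (_∸ k) length-sequence) (m+n∸m≡n k a)) ⟩
    applyUpTo (λ j → take k (drop j sequence)) (suc a)
      ≡⟨ applyUpTo-cong _ _ (suc a) window-j ⟩
    applyUpTo (λ j → drop j P ++ M ++ take j Q) (suc a) ∎
    where
    open ≡-Reasoning
    window-j : ∀ {j} → j < suc a → take k (drop j sequence) ≡ drop j P ++ M ++ take j Q
    window-j {j} (s≤s j≤a) = trans (cong (λ k → take k (drop j sequence)) (sym |P|+|M|≡k))
                                    (take-drop-middle P M Q j (subst (j ≤_) (sym |P|≡a) j≤a))

windowSet : ∀ {k a} → Split k a (Fin m) → ℕ → Subset m
windowSet s j = toSet (drop j P ++ M ++ take j Q) where open Split s

windowSets-sequence : ∀ {k a} (s : Split k a (Fin m)) (vs : List⁺ (Fin m)) → 1 ≤ k →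
  toList vs ≡ sequence s → windowSets k vs ≡ applyUpTo (windowSet s) (suc a)
windowSets-sequence {k = k} {a} s vs 1≤k vs≡s = begin
  map toSet (windows k (toList vs))
    ≡⟨ cong (map toSet) (trans (cong (windows k) vs≡s) (windows-sequence s 1≤k)) ⟩
  map toSet (applyUpTo (λ j → drop j P ++ M ++ take j Q) (suc a))
    ≡⟨ map-applyUpTo (λ j → drop j P ++ M ++ take j Q) toSet (suc a) ⟩
  applyUpTo (windowSet s) (suc a) ∎
  where
  open ≡-Reasoning
  open Split s

fromList⁺ : (xs : List A) → 1 ≤ length xs → ∃ λ (vs : List⁺ A) → toList vs ≡ xs
fromList⁺ (x ∷ xs) _ = x ∷ xs , refl

module _ {k} (H : UniformHypergraph k) {l} (1≤k : 1 ≤ k) (l≤k : l ≤ k)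
         (free : SemicycleFree H) (short : ∀ vs → IsSubChain H vs → chainLength k vs ≤ l) where

  private
    Vertex VSet : Set
    Vertex = Fin (n H)
    VSet = Subset (n H)

  PrivateFace : List VSet → VSet → VSet → Set
  PrivateFace E W f = ∣ f ∣ ≡ k ∸ 1 × f ⊆ W × (∀ {e} → e ∈ E → f ⊆ e → e ≡ W)

  record PrivateFaces (E : List VSet) : Set where
    field
      W : VSet
      W∈E : W ∈ E
      faces : List VSet
      faces-unique : Unique faces
      faces-private : All (PrivateFace E W) faces
      many-faces : k ∸ l + 1 ≤ length faces

  module _ (E : List VSet) (E⊆H : All (_∈ edges H) E) where

    ∣e∣≡k : ∀ {e} → e ∈ E → ∣ e ∣ ≡ k
    ∣e∣≡k e∈E = All.lookup (uniform H) (All.lookup E⊆H e∈E)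

    record Chain (a : ℕ) : Set where
      field
        split : Split k a Vertex
        windows∈E : All (_∈ E) (applyUpTo (windowSet split) (suc a))
        windows-unique : Unique (applyUpTo (windowSet split) (suc a))
      open Split split public

    chain⇒SubSeq : ∀ {a} → Chain a → ∃ λ vs → SubSeq H vs × chainLength k vs ≡ suc a
    chain⇒SubSeq {a} c with vs , vs≡ ← fromList⁺ (sequence (Chain.split c)) (≤-trans 1≤k (k≤length-sequence (Chain.split c))) =
      vs , (k≤|vs| , windowSets-unique , windowSets⊆H) , |windows|≡1+a
      where
      open Chain c
      ws≡ : windowSets k vs ≡ applyUpTo (windowSet split) (suc a)
      ws≡ = windowSets-sequence split vs 1≤k vs≡
      k≤|vs| : k ≤ length (toList vs)
      k≤|vs| = subst (k ≤_) (sym (cong length vs≡)) (k≤length-sequence split)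
      windowSets-unique = subst Unique (sym ws≡) windows-unique
      windowSets⊆H = subst (All (_∈ edges H)) (sym ws≡) (All.map (All.lookup E⊆H) windows∈E)
      |windows|≡1+a : chainLength k vs ≡ suc a
      |windows|≡1+a = begin
        length (windows k (toList vs))           ≡⟨ length-map toSet (windows k (toList vs)) ⟨
        length (windowSets k vs)                 ≡⟨ cong length ws≡ ⟩
        length (applyUpTo (windowSet split) (suc a)) ≡⟨ length-applyUpTo (windowSet split) (suc a) ⟩
        suc a                                    ∎
        where open ≡-Reasoning

    chain-length≤l : ∀ {a} → Chain a → suc a ≤ l
    chain-length≤l c with vs , sub , |vs|≡ ← chain⇒SubSeq c | head vs ≟ᶠ last vs
    ... | yes closed = ⊥-elim (free vs (sub , closed))
    ... | no unclosed = subst (_≤ l) |vs|≡ (short vs (sub , unclosed))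

    module _ {a} (c : Chain a) where
      open Chain c

      top : VSet
      top = toSet (M ++ Q)

      windowSet-a≡top : windowSet split a ≡ top
      windowSet-a≡top = cong₂ (λ D T → toSet (D ++ M ++ T))
        (drop-all a P (≤-reflexive |P|≡a)) (take-all a Q (≤-reflexive |Q|≡a))

      top∈E : top ∈ E
      top∈E = subst (_∈ E) windowSet-a≡top (All.lookup windows∈E (∈-applyUpTo⁺ (windowSet split) ≤-refl))

      ∣top∣≡k : ∣ top ∣ ≡ k
      ∣top∣≡k = ∣e∣≡k top∈E

      length-M++Q : length (M ++ Q) ≡ k
      length-M++Q = begin
        length (M ++ Q)       ≡⟨ length-++ M ⟩
        length M + length Q   ≡⟨ +-comm (length M) _ ⟩
        length Q + length M   ≡⟨ cong (_+ length M) (trans |Q|≡a (sym |P|≡a)) ⟩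
        length P + length M   ≡⟨ |P|+|M|≡k ⟩
        k                     ∎
        where open ≡-Reasoning

      M-unique : Unique M
      M-unique = Unique-++⁻ˡ M (length≤∣toSet∣⇒Unique (M ++ Q) (≤-reflexive (trans length-M++Q (sym ∣top∣≡k))))

      M⊆top : ∀ {x} → x ∈ M → x ∈ₛ top
      M⊆top = ∈-toSet⁺ ∘ ∈-++⁺ˡ

      k∸l+1≤length-M : k ∸ l + 1 ≤ length M
      k∸l+1≤length-M = begin
        k ∸ l + 1             ≡⟨ +-comm (k ∸ l) 1 ⟩
        suc (k ∸ l)           ≡⟨ +-∸-assoc 1 l≤k ⟨
        suc k ∸ l             ≤⟨ ∸-monoʳ-≤ (suc k) (chain-length≤l c) ⟩
        k ∸ a                 ≡⟨ cong (_∸ a) (trans (sym |P|+|M|≡k) (cong (_+ length M) |P|≡a)) ⟩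
        a + length M ∸ a      ≡⟨ m+n∸m≡n a (length M) ⟩
        length M              ∎
        where open ≤-Reasoning

      Extends : Vertex → VSet → Set
      Extends x e = top - x ⊆ e × e ≢ top

      module _ {x e} (x∈M : x ∈ M) (e∈E : e ∈ E) (top-x⊆e : top - x ⊆ e) (e≢top : e ≢ top) where

        e⊆top⇒e≡top : e ⊆ top → e ≡ top
        e⊆top⇒e≡top e⊆top = p⊆q∧∣q∣≤∣p∣⇒p≡q e⊆top (≤-reflexive (trans ∣top∣≡k (sym (∣e∣≡k e∈E))))

        x∉e : x ∉ₛ e
        x∉e x∈e = e≢top (sym (p⊆q∧∣q∣≤∣p∣⇒p≡q top⊆e (≤-reflexive (trans (∣e∣≡k e∈E) (sym ∣top∣≡k)))))
          where
          top⊆e : top ⊆ e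
          top⊆e {z} z∈top with z ≟ᶠ x
          ... | yes refl = x∈e
          ... | no z≢x = top-x⊆e (x∈p∧x≢y⇒x∈p-y z∈top z≢x)

        M′ : List Vertex
        M′ = proj₁ (∈⇒↭∷ x∈M)

        M↭x∷M′ : M ↭ x ∷ M′
        M↭x∷M′ = proj₂ (∈⇒↭∷ x∈M)

        new-vertex : ∃ λ y → y ∈ₛ e × y ∉ₛ top
        new-vertex = p⊈q⇒∃∈∉ (e≢top ∘ e⊆top⇒e≡top)

        y : Vertex
        y = proj₁ new-vertex

        split′ : Split k (suc a) Vertex
        split′ = record
          { P = P ++ [ x ]
          ; M = M′
          ; Q = Q ++ [ y ]
          ; |P|≡a = trans (length-∷ʳ P) (cong suc |P|≡a)
          ; |Q|≡a = trans (length-∷ʳ Q) (cong suc |Q|≡a)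
          ; |P|+|M|≡k = begin
              length (P ++ [ x ]) + length M′ ≡⟨ cong (_+ length M′) (length-∷ʳ P) ⟩
              suc (length P) + length M′      ≡⟨ +-suc (length P) (length M′) ⟨
              length P + length (x ∷ M′)      ≡⟨ cong (length P +_) (↭-length M↭x∷M′) ⟨
              length P + length M             ≡⟨ |P|+|M|≡k ⟩
              k                               ∎
          }
          where open ≡-Reasoning

        old-windows : ∀ {j} → j < suc a → windowSet split′ j ≡ windowSet split j
        old-windows {j} (s≤s j≤a) = begin
          toSet (drop j (P ++ [ x ]) ++ M′ ++ take j (Q ++ [ y ]))
            ≡⟨ cong₂ (λ D T → toSet (D ++ M′ ++ T))
                     (drop-++ˡ j P [ x ] (subst (j ≤_) (sym |P|≡a) j≤a))
                     (take-++ˡ j Q [ y ] (subst (j ≤_) (sym |Q|≡a) j≤a)) ⟩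
          toSet ((drop j P ++ [ x ]) ++ M′ ++ take j Q)
            ≡⟨ cong toSet (++-assoc (drop j P) [ x ] (M′ ++ take j Q)) ⟩
          toSet (drop j P ++ (x ∷ M′) ++ take j Q)
            ≡⟨ toSet-resp-↭ (++⁺ˡ (drop j P) (++⁺ʳ (take j Q) (↭-sym M↭x∷M′))) ⟩
          toSet (drop j P ++ M ++ take j Q) ∎
          where open ≡-Reasoning

        new-window : windowSet split′ (suc a) ≡ e
        new-window = begin
          toSet (drop (suc a) (P ++ [ x ]) ++ M′ ++ take (suc a) (Q ++ [ y ]))
            ≡⟨ cong₂ (λ D T → toSet (D ++ M′ ++ T))
                     (drop-all (suc a) (P ++ [ x ]) (≤-reflexive (Split.|P|≡a split′)))
                     (take-all (suc a) (Q ++ [ y ]) (≤-reflexive (Split.|Q|≡a split′))) ⟩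
          toSet (M′ ++ Q ++ [ y ])
            ≡⟨ cong toSet (++-assoc M′ Q [ y ]) ⟨
          toSet ((M′ ++ Q) ++ [ y ])
            ≡⟨ exchange (M′ ++ Q) (toSet-resp-↭ (↭-sym M++Q↭)) (trans ∣top∣≡k (sym (∣e∣≡k e∈E)))
                        (≤-reflexive (trans (sym (↭-length M++Q↭)) (trans length-M++Q (sym (∣e∣≡k e∈E)))))
                        top-x⊆e (proj₁ (proj₂ new-vertex)) (proj₂ (proj₂ new-vertex)) ⟩
          e ∎
          where
          open ≡-Reasoning
          M++Q↭ : M ++ Q ↭ x ∷ M′ ++ Q
          M++Q↭ = ++⁺ʳ Q M↭x∷M′

        e∉windows : e ∉ applyUpTo (windowSet split) (suc a)
        e∉windows e∈ with j , _ , e≡ ← ∈-applyUpTo⁻ (windowSet split) e∈ =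
          x∉e (subst (x ∈ₛ_) (sym e≡) (∈-toSet⁺ (∈-++⁺ʳ (drop j P) (∈-++⁺ˡ x∈M))))

        windows′ : applyUpTo (windowSet split′) (suc (suc a)) ≡ applyUpTo (windowSet split) (suc a) ++ [ e ]
        windows′ = trans (sym (applyUpTo-∷ʳ (windowSet split′) (suc a)))
                         (cong₂ _∷ʳ_ (applyUpTo-cong _ _ (suc a) old-windows) new-window)

        extend : Chain (suc a)
        extend = record
          { split = split′
          ; windows∈E = subst (All (_∈ E)) (sym windows′) (All.∷ʳ⁺ windows∈E e∈E)
          ; windows-unique = subst Unique (sym windows′)
              (Unique.++⁺ windows-unique ([] ∷ []) λ { (e∈ , here refl) → e∉windows e∈ })
          }

      stuck⇒PrivateFaces : (∀ {x e} → x ∈ M → e ∈ E → ¬ Extends x e) → PrivateFaces E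
      stuck⇒PrivateFaces stuck = record
        { W = top
        ; W∈E = top∈E
        ; faces = map (top -_) M
        ; faces-unique = removals-unique (All.tabulate M⊆top) M-unique
        ; faces-private = All.map⁺ (All.tabulate top-x-private)
        ; many-faces = subst (k ∸ l + 1 ≤_) (sym (length-map (top -_) M)) k∸l+1≤length-M
        }
        where
        top-x-private : ∀ {x} → x ∈ M → PrivateFace E top (top - x)
        top-x-private x∈M = cong (_∸ 1) (trans (x∈p⇒1+∣p-x∣≡∣p∣ (M⊆top x∈M)) ∣top∣≡k) , p─q⊆p top ⁅ _ ⁆ , only-top
          where
          only-top : ∀ {e} → e ∈ E → top - _ ⊆ e → e ≡ top
          only-top {e} e∈E top-x⊆e with ≡-dec _≟ᵇ_ e top
          ... | yes e≡top = e≡top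
          ... | no e≢top = ⊥-elim (stuck x∈M e∈E (top-x⊆e , e≢top))

      step : PrivateFaces E ⊎ Chain (suc a)
      step with any? (λ x → any? (λ e → (top - x ⊆? e) ×-dec ¬? (≡-dec _≟ᵇ_ e top)) E) M
      ... | yes extension
        with _ , x∈M , extends ← find extension
        with _ , e∈E , (top-x⊆e , e≢top) ← find extends = inj₂ (extend x∈M e∈E top-x⊆e e≢top)
      ... | no none = inj₁ (stuck⇒PrivateFaces λ x∈M e∈E extends → none (lose x∈M (lose e∈E extends)))

    grow : ∀ d {a} → a + d ≡ l → Chain a → PrivateFaces E
    grow zero {a} a+0≡l c = ⊥-elim (<-irrefl (trans (sym (+-identityʳ a)) a+0≡l) (chain-length≤l c))
    grow (suc d) {a} a+d≡l c with step c
    ... | inj₁ faces = faces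
    ... | inj₂ c′ = grow d (trans (sym (+-suc a d)) a+d≡l) c′

    edgeChain : ∀ {e} → e ∈ E → Chain 0
    edgeChain {e} e∈E = record
      { split = record { P = [] ; M = elements e ; Q = [] ; |P|≡a = refl ; |Q|≡a = refl
                       ; |P|+|M|≡k = trans (length-elements e) (∣e∣≡k e∈E) }
      ; windows∈E = subst (_∈ E) (sym (trans (cong toSet (++-identityʳ (elements e))) (toSet-elements e))) e∈E ∷ []
      ; windows-unique = [] ∷ []
      }

    privateFaces : ∀ {e} → e ∈ E → PrivateFaces E
    privateFaces e∈E = grow l refl (edgeChain e∈E)

  record FaceFamily (E : List VSet) : Set where
    field
      faces : List VSet
      faces-unique : Unique faces
      faces-size : All (λ f → ∣ f ∣ ≡ k ∸ 1) faces
      faces-covered : All (λ f → ∃ λ e → e ∈ E × f ⊆ e) faces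
      many-faces : (k ∸ l + 1) * length E ≤ length faces

  -- Faces private to W lie in no edge of E other than W, so they avoid the faces of the rest.
  faceFamily : ∀ d (E : List VSet) → length E ≡ d → Unique E → All (_∈ edges H) E → FaceFamily E
  faceFamily _ [] _ _ _ = record
    { faces = [] ; faces-unique = [] ; faces-size = [] ; faces-covered = []
    ; many-faces = ≤-reflexive (*-zeroʳ (k ∸ l + 1)) }
  faceFamily (suc d) E@(_ ∷ _) |E|≡1+d E-unique E⊆H
    with record { W = W ; W∈E = W∈E ; faces = F ; faces-unique = F-unique
                ; faces-private = F-private ; many-faces = many-F } ← privateFaces E E⊆H (here refl)
    with E′ , E↭W∷E′ ← ∈⇒↭∷ W∈E
    with W≢E′ ∷ E′-unique ← Unique-resp-↭ E↭W∷E′ E-unique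
    with _ ∷ E′⊆H ← All-resp-↭ E↭W∷E′ E⊆H = record
    { faces = F ++ G
    ; faces-unique = Unique.++⁺ F-unique G-unique F∩G≡∅
    ; faces-size = All.++⁺ (All.map proj₁ F-private) G-size
    ; faces-covered = All.++⁺ (All.map (λ (_ , f⊆W , _) → W , W∈E , λ {x} → f⊆W {x}) F-private)
                              (All.map (λ (e , e∈E′ , f⊆e) → e , E′⊆E e∈E′ , λ {x} → f⊆e {x}) G-covered)
    ; many-faces = begin
        (k ∸ l + 1) * length E                    ≡⟨ cong ((k ∸ l + 1) *_) |E|≡1+|E′| ⟩
        (k ∸ l + 1) * suc (length E′)             ≡⟨ *-suc (k ∸ l + 1) (length E′) ⟩
        (k ∸ l + 1) + (k ∸ l + 1) * length E′     ≤⟨ +-mono-≤ many-F many-G ⟩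
        length F + length G                       ≡⟨ length-++ F ⟨
        length (F ++ G)                           ∎
    }
    where
    open ≤-Reasoning
    E′⊆E : ∀ {e} → e ∈ E′ → e ∈ E
    E′⊆E = ∈-resp-↭ (↭-sym E↭W∷E′) ∘ there
    |E|≡1+|E′| : length E ≡ suc (length E′)
    |E|≡1+|E′| = ↭-length E↭W∷E′
    open FaceFamily (faceFamily d E′ (suc-injective (trans (sym |E|≡1+|E′|) |E|≡1+d)) E′-unique E′⊆H)
      renaming (faces to G; faces-unique to G-unique; faces-size to G-size;
                faces-covered to G-covered; many-faces to many-G)
    F∩G≡∅ : ∀ {f} → ¬ (f ∈ F × f ∈ G)
    F∩G≡∅ (f∈F , f∈G) with e , e∈E′ , f⊆e ← All.lookup G-covered f∈G =
      All.lookup W≢E′ e∈E′ (sym (proj₂ (proj₂ (All.lookup F-private f∈F)) (E′⊆E e∈E′) f⊆e))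

mainTheorem12 : (k l : ℕ) → 1 ≤ l → l ≤ k → (H : UniformHypergraph k) →
    IsLHypertree l H →
    (k ∸ l + 1) * numEdges H ≤ n H C (k ∸ 1)
mainTheorem12 k l 1≤l l≤k H ((_ , free) , short) =
  ≤-trans many-faces (length≤C (n H) (k ∸ 1) faces faces-unique faces-size)
  where
  open FaceFamily (faceFamily H (≤-trans 1≤l l≤k) l≤k free short _ (edges H) refl (distinct H) (All.tabulate id))
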